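{- Let $L$ be a Latin square with a row cycle $\rho$ of length $3$. Suppose that $S$ is a subsquare of $L$ that contains more than one entry of $\rho$. Then $S$ contains all entries of $\rho$.
   Context: A Latin square of order $n$ is an $n\times n$ matrix (rows, columns and symbols indexed by $[n]$) with each symbol once in each row and column; entries are triples (row, column, symbol). A subsquare is a $k\times k$ submatrix (on any $k$ rows and $k$ columns) that is itself a Latin square. For distinct rows $i,j$, the row permutation $\tau_{i,j}$ is the permutation of symbols defined by $\tau_{i,j}(L[i,k])=L[j,k]$ for all columns $k$. If $\rho$ is a cycle of $\tau_{i,j}$ and $C$ is the set of columns in which the symbols of that cycle occur in row $i$, the set of entries of $L$ in the cells $\{i,j\}\times C$ is called a row cycle of $L$, of length $|C|$. -}

module Defs where

open import Data.Nat using (ℕ)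
open import Data.Fin using (Fin; zero; suc)
open import Data.Fin.Subset using (Subset; _∈_; ∣_∣)
open import Data.Product using (Σ; ∃; _×_; _,_)
open import Data.Sum using (_⊎_)
open import Relation.Binary.PropositionalEquality using (_≡_)
open import Relation.Nullary using (¬_)
open import Function.Definitions using (Injective)

Array : ℕ → Set
Array n = Fin n → Fin n → Fin n

IsLatin : ∀ {n} → Array n → Set
IsLatin {n} L =
  (∀ (r : Fin n) → Injective _≡_ _≡_ (L r)) ×
  (∀ (c : Fin n) → Injective _≡_ _≡_ (λ r → L r c)) ×
  (∀ (r s : Fin n) → ∃ λ c → L r c ≡ s) ×
  (∀ (c s : Fin n) → ∃ λ r → L r c ≡ s)

-- Subsquare on row set R and column set C: a k×k submatrix (|R| = |C| = k)
-- that is itself a Latin square, i.e. there is a set Sym of k symbols such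
-- that every cell of R×C carries a symbol of Sym and every symbol of Sym
-- occurs in every row of R (within C) and in every column of C (within R).
-- (Uniqueness of occurrences is inherited from L being Latin.)
IsSubsquare : ∀ {n} → Array n → Subset n → Subset n → Set
IsSubsquare {n} L R C = Σ (Subset n) λ Sym →
  (∣ C ∣ ≡ ∣ R ∣) × (∣ Sym ∣ ≡ ∣ R ∣) ×
  (∀ r c → r ∈ R → c ∈ C → L r c ∈ Sym) ×
  (∀ r s → r ∈ R → s ∈ Sym → ∃ λ c → c ∈ C × L r c ≡ s) ×
  (∀ c s → c ∈ C → s ∈ Sym → ∃ λ r → r ∈ R × L r c ≡ s)

IsRowPerm : ∀ {n} → Array n → Fin n → Fin n → (Fin n → Fin n) → Set
IsRowPerm {n} L i j τ = ∀ (k : Fin n) → τ (L i k) ≡ L j k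

Is3Cycle : ∀ {n} → (Fin n → Fin n) → (Fin 3 → Fin n) → Set
Is3Cycle τ s =
  Injective _≡_ _≡_ s ×
  (τ (s zero) ≡ s (suc zero)) ×
  (τ (s (suc zero)) ≡ s (suc (suc zero))) ×
  (τ (s (suc (suc zero))) ≡ s zero)

-- The cell (r , c) is an entry of the row cycle of L determined by rows
-- i, j and the cycle s: r ∈ {i, j} and column c is one where row i carries
-- a symbol of the cycle.  (The symbol of the entry is L r c.)
InRowCycle : ∀ {n} → Array n → Fin n → Fin n → (Fin 3 → Fin n) →
             Fin n → Fin n → Set
InRowCycle L i j s r c = (r ≡ i ⊎ r ≡ j) × ∃ λ t → L i c ≡ s t

InSub : ∀ {n} → Subset n → Subset n → Fin n → Fin n → Set
InSub R C r c = r ∈ R × c ∈ C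

-- The row cycle lies in rows i, j and columns c₀, c₁, c₂, where row i carries
-- s t and row j carries s (t + 1) in column c_t.  For a subsquare on R × C with
-- symbol set Sym, any two of "r ∈ R", "c ∈ C", "L r c ∈ Sym" force the third.
-- Two entries of the cycle in the subsquare put both rows i and j into R: either
-- they already lie in different rows, or they lie in one row in columns c_t and
-- c_(t+1), and the symbol shared by (i , c_(t+1)) and (j , c_t) pulls in the
-- other row.  With i, j ∈ R, the symbol shared by (j , c_t) and (i , c_(t+1))
-- moves every cycle column in C on to the next one, so all three lie in C.
module Submission where

open import Defs
open import Data.Nat using (ℕ)
open import Data.Fin using (Fin; zero; suc)
open import Data.Fin.Subset using (Subset; _∈_)
open import Data.Product using (_×_; _,_; proj₁; proj₂; ∃)
open import Data.Sum using (_⊎_; inj₁; inj₂)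
open import Data.Empty using (⊥-elim)
open import Relation.Binary.PropositionalEquality using (_≡_; _≢_; refl; sym; trans; cong; subst)
open import Relation.Nullary using (¬_)
open import Function.Definitions using (Injective)

variable
  n : ℕ
  L : Array n
  R C : Subset n
  r c : Fin n

next : Fin 3 → Fin 3
next zero = suc zero
next (suc zero) = suc (suc zero)
next (suc (suc zero)) = zero

next-or-previous : {t u : Fin 3} → t ≢ u → u ≡ next t ⊎ t ≡ next u
next-or-previous {zero} {zero} t≢u = ⊥-elim (t≢u refl)
next-or-previous {zero} {suc zero} _ = inj₁ refl
next-or-previous {zero} {suc (suc zero)} _ = inj₂ refl
next-or-previous {suc zero} {zero} _ = inj₂ refl
next-or-previous {suc zero} {suc zero} t≢u = ⊥-elim (t≢u refl)
next-or-previous {suc zero} {suc (suc zero)} _ = inj₁ refl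
next-or-previous {suc (suc zero)} {zero} _ = inj₁ refl
next-or-previous {suc (suc zero)} {suc zero} _ = inj₂ refl
next-or-previous {suc (suc zero)} {suc (suc zero)} t≢u = ⊥-elim (t≢u refl)

next-closed⇒all : ∀ {p} (P : Fin 3 → Set p) → (∀ {t} → P t → P (next t)) →
                  ∀ {t} → P t → ∀ u → P u
next-closed⇒all P step {t} Pt = from-zero (to-zero t Pt)
  where
  to-zero : ∀ t → P t → P zero
  to-zero zero P₀ = P₀
  to-zero (suc zero) P₁ = step (step P₁)
  to-zero (suc (suc zero)) P₂ = step P₂

  from-zero : P zero → ∀ u → P u
  from-zero P₀ zero = P₀
  from-zero P₀ (suc zero) = step P₀
  from-zero P₀ (suc (suc zero)) = step (step P₀)

row-injective : IsLatin L → ∀ r → Injective _≡_ _≡_ (L r)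
row-injective = proj₁

column-injective : IsLatin L → ∀ c → Injective _≡_ _≡_ (λ r → L r c)
column-injective latin = proj₁ (proj₂ latin)

row-surjective : IsLatin L → ∀ r x → ∃ λ c → L r c ≡ x
row-surjective latin = proj₁ (proj₂ (proj₂ latin))

symbols : {L : Array n} {R C : Subset n} → IsSubsquare L R C → Subset n
symbols = proj₁

symbol∈ : (sub : IsSubsquare L R C) → r ∈ R → c ∈ C → L r c ∈ symbols sub
symbol∈ (_ , _ , _ , cells , _) = cells _ _

column∈ : IsLatin L → (sub : IsSubsquare L R C) →
          r ∈ R → L r c ∈ symbols sub → c ∈ C
column∈ {L = L} {C = C} {r = r} latin (_ , _ , _ , _ , in-row , _) r∈R x∈
  with in-row r (L r _) r∈R x∈
... | c′ , c′∈C , Lrc′≡Lrc = subst (_∈ C) (row-injective latin r Lrc′≡Lrc) c′∈C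

row∈ : IsLatin L → (sub : IsSubsquare L R C) →
       c ∈ C → L r c ∈ symbols sub → r ∈ R
row∈ {L = L} {R = R} {c = c} latin (_ , _ , _ , _ , _ , in-column) c∈C x∈
  with in-column c (L _ c) c∈C x∈
... | r′ , r′∈R , Lr′c≡Lrc = subst (_∈ R) (column-injective latin c Lr′c≡Lrc) r′∈R

module RowCycle {L : Array n} (latin : IsLatin L) {i j : Fin n}
                {τ : Fin n → Fin n} (τ-row : IsRowPerm L i j τ)
                {s : Fin 3 → Fin n} (cycle : Is3Cycle τ s) where

  τ-next : ∀ t → τ (s t) ≡ s (next t)
  τ-next zero = proj₁ (proj₂ cycle)
  τ-next (suc zero) = proj₁ (proj₂ (proj₂ cycle))
  τ-next (suc (suc zero)) = proj₂ (proj₂ (proj₂ cycle))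

  column : Fin 3 → Fin n
  column t = proj₁ (row-surjective latin i (s t))

  row-i : ∀ t → L i (column t) ≡ s t
  row-i t = proj₂ (row-surjective latin i (s t))

  row-j : ∀ t → L j (column t) ≡ s (next t)
  row-j t = trans (sym (τ-row (column t))) (trans (cong τ (row-i t)) (τ-next t))

  column-unique : ∀ {t} → L i c ≡ s t → c ≡ column t
  column-unique {t = t} Lic≡st = row-injective latin i (trans Lic≡st (sym (row-i t)))

  column∈-unique : ∀ {t} → L i c ≡ s t → c ∈ C → column t ∈ C
  column∈-unique {C = C} Lic≡st = subst (_∈ C) (column-unique Lic≡st)

  distinct-entries⇒distinct-symbols : ∀ {k : Fin n} {c₁ c₂ t₁ t₂} → (k , c₁) ≢ (k , c₂) →
                                      L i c₁ ≡ s t₁ → L i c₂ ≡ s t₂ → t₁ ≢ t₂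
  distinct-entries⇒distinct-symbols distinct e₁ e₂ refl =
    distinct (cong (_ ,_) (trans (column-unique e₁) (sym (column-unique e₂))))

  shared-symbol : ∀ t → L j (column t) ≡ L i (column (next t))
  shared-symbol t = trans (row-j t) (sym (row-i (next t)))

  module _ (sub : IsSubsquare L R C) where

    adjacent-in-row-i⇒j∈R : ∀ {t} → i ∈ R → column t ∈ C → column (next t) ∈ C → j ∈ R
    adjacent-in-row-i⇒j∈R {t} i∈R cₜ∈C cₜ₊₁∈C = row∈ latin sub cₜ∈C
      (subst (_∈ symbols sub) (sym (shared-symbol t)) (symbol∈ sub i∈R cₜ₊₁∈C))

    adjacent-in-row-j⇒i∈R : ∀ {t} → j ∈ R → column t ∈ C → column (next t) ∈ C → i ∈ R
    adjacent-in-row-j⇒i∈R {t} j∈R cₜ∈C cₜ₊₁∈C = row∈ latin sub cₜ₊₁∈C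
      (subst (_∈ symbols sub) (shared-symbol t) (symbol∈ sub j∈R cₜ∈C))

    pair-in-row-i⇒j∈R : ∀ {t u} → i ∈ R → t ≢ u → column t ∈ C → column u ∈ C → j ∈ R
    pair-in-row-i⇒j∈R i∈R t≢u cₜ∈C cᵤ∈C with next-or-previous t≢u
    ... | inj₁ refl = adjacent-in-row-i⇒j∈R i∈R cₜ∈C cᵤ∈C
    ... | inj₂ refl = adjacent-in-row-i⇒j∈R i∈R cᵤ∈C cₜ∈C

    pair-in-row-j⇒i∈R : ∀ {t u} → j ∈ R → t ≢ u → column t ∈ C → column u ∈ C → i ∈ R
    pair-in-row-j⇒i∈R j∈R t≢u cₜ∈C cᵤ∈C with next-or-previous t≢u
    ... | inj₁ refl = adjacent-in-row-j⇒i∈R j∈R cₜ∈C cᵤ∈C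
    ... | inj₂ refl = adjacent-in-row-j⇒i∈R j∈R cᵤ∈C cₜ∈C

    two-entries⇒both-rows : ∀ {r₁ c₁ r₂ c₂} → (r₁ , c₁) ≢ (r₂ , c₂) →
      InRowCycle L i j s r₁ c₁ → InSub R C r₁ c₁ →
      InRowCycle L i j s r₂ c₂ → InSub R C r₂ c₂ → i ∈ R × j ∈ R
    two-entries⇒both-rows _ (inj₁ refl , _) (i∈R , _) (inj₂ refl , _) (j∈R , _) = i∈R , j∈R
    two-entries⇒both-rows _ (inj₂ refl , _) (j∈R , _) (inj₁ refl , _) (i∈R , _) = i∈R , j∈R
    two-entries⇒both-rows distinct (inj₁ refl , _ , e₁) (i∈R , c₁∈C) (inj₁ refl , _ , e₂) (_ , c₂∈C) =
      i∈R , pair-in-row-i⇒j∈R i∈R (distinct-entries⇒distinct-symbols distinct e₁ e₂)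
                              (column∈-unique e₁ c₁∈C) (column∈-unique e₂ c₂∈C)
    two-entries⇒both-rows distinct (inj₂ refl , _ , e₁) (j∈R , c₁∈C) (inj₂ refl , _ , e₂) (_ , c₂∈C) =
      pair-in-row-j⇒i∈R j∈R (distinct-entries⇒distinct-symbols distinct e₁ e₂)
                          (column∈-unique e₁ c₁∈C) (column∈-unique e₂ c₂∈C) , j∈R

    next-column∈ : i ∈ R → j ∈ R → ∀ {t} → column t ∈ C → column (next t) ∈ C
    next-column∈ i∈R j∈R {t} cₜ∈C = column∈ latin sub i∈R
      (subst (_∈ symbols sub) (shared-symbol t) (symbol∈ sub j∈R cₜ∈C))

    both-rows⇒all-entries : i ∈ R → j ∈ R → ∀ {t} → column t ∈ C →
                            InRowCycle L i j s r c → InSub R C r c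
    both-rows⇒all-entries i∈R j∈R cₜ∈C (r≡i⊎r≡j , u , Lic≡su) =
      row-in-R r≡i⊎r≡j ,
      subst (_∈ C) (sym (column-unique Lic≡su))
            (next-closed⇒all (λ t → column t ∈ C) (next-column∈ i∈R j∈R) cₜ∈C u)
      where
      row-in-R : r ≡ i ⊎ r ≡ j → r ∈ R
      row-in-R (inj₁ refl) = i∈R
      row-in-R (inj₂ refl) = j∈R

lemma3p4 : ∀ {n : ℕ} (L : Array n) → IsLatin L →
    ∀ (i j : Fin n) → ¬ (i ≡ j) →
    ∀ (τ : Fin n → Fin n) → IsRowPerm L i j τ →
    ∀ (s : Fin 3 → Fin n) → Is3Cycle τ s →
    ∀ (R C : Subset n) → IsSubsquare L R C →
    ∀ (r₁ c₁ r₂ c₂ : Fin n) → ¬ ((r₁ , c₁) ≡ (r₂ , c₂)) →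
    InRowCycle L i j s r₁ c₁ → InSub R C r₁ c₁ →
    InRowCycle L i j s r₂ c₂ → InSub R C r₂ c₂ →
    ∀ (r c : Fin n) → InRowCycle L i j s r c → InSub R C r c
lemma3p4 L latin i j _ τ τ-row s cycle R C sub _ _ _ _ distinct
         entry₁@(_ , _ , Lic₁≡st) in-sub₁@(_ , c₁∈C) entry₂ in-sub₂ _ _ =
  let i∈R , j∈R = two-entries⇒both-rows sub distinct entry₁ in-sub₁ entry₂ in-sub₂
  in both-rows⇒all-entries sub i∈R j∈R (column∈-unique Lic₁≡st c₁∈C)
  where open RowCycle latin {i} {j} {τ} τ-row cycle
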